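{- Let $k\ge 2$ and $e\ge 3$. If there exists a $k$-chromatic $e$-star system of order $n_0$ with $n_0\equiv 0$ or $1\pmod{2e}$, then there exists a $k$-chromatic $e$-star system of order $n$ for every $n>n_0$ with $n\equiv 0$ or $1\pmod{2e}$.
   Context: An $e$-star is the complete bipartite graph $K_{1,e}$. An $e$-star system of order $n$ is a pair $(V,\mathcal B)$ where $|V|=n$ and $\mathcal B$ is a set of $e$-stars (subgraphs of the complete graph $K_n$ on $V$) whose edge sets partition the edge set of $K_n$. An $e$-star system is $k$-colourable if $V$ can be partitioned into $k$ sets (colour classes) such that no star in $\mathcal B$ has all its vertices in the same class; it is $k$-chromatic if it is $k$-colourable but not $(k-1)$-colourable. -}

module Defs where

open import Data.Nat using (ℕ; suc; _∸_)
open import Data.Fin using (Fin)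
open import Data.Vec using (Vec)
open import Data.Vec.Membership.Propositional using (_∈_)
open import Data.Vec.Relation.Unary.AllPairs using (AllPairs)
open import Data.Vec.Relation.Unary.All using (All)
open import Data.List using (List; length; lookup)
open import Data.Product using (Σ; ∃; _×_)
open import Data.Sum using (_⊎_)
open import Relation.Binary.PropositionalEquality using (_≡_; _≢_)
open import Relation.Nullary using (¬_)

record Star (n e : ℕ) : Set where
  constructor star
  field
    centre        : Fin n
    leaves        : Vec (Fin n) e
    leavesDistinct : AllPairs _≢_ leaves
    leavesNotCentre : All (λ v → v ≢ centre) leaves
open Star public

EdgeIn : ∀ {n e} → Fin n → Fin n → Star n e → Set
EdgeIn u v s = (centre s ≡ u × v ∈ leaves s) ⊎ (centre s ≡ v × u ∈ leaves s)

IsStarSystem : ∀ {n e} → List (Star n e) → Set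
IsStarSystem B =
  ∀ u v → u ≢ v →
    Σ (Fin (length B)) (λ i → EdgeIn u v (lookup B i)) ×
    (∀ i j → EdgeIn u v (lookup B i) → EdgeIn u v (lookup B j) → i ≡ j)

Monochromatic : ∀ {n e k} → (Fin n → Fin k) → Star n e → Set
Monochromatic c s = All (λ v → c v ≡ c (centre s)) (leaves s)

Colourable : ∀ {n e} → ℕ → List (Star n e) → Set
Colourable {n} k B =
  Σ (Fin n → Fin k) (λ c → ∀ (i : Fin (length B)) → ¬ Monochromatic c (lookup B i))

Chromatic : ∀ {n e} → ℕ → List (Star n e) → Set
Chromatic k B = Colourable k B × ¬ Colourable (k ∸ 1) B

ExistsChromaticStarSystem : ℕ → ℕ → ℕ → Set
ExistsChromaticStarSystem k e n =
  Σ (List (Star n e)) (λ B → IsStarSystem B × Chromatic k B)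

-- Adding m new vertices to an e-star system on a vertices: each new vertex w becomes the centre
-- of g new stars whose leaves are all old vertices together with the out-neighbours of w in a
-- regular tournament of out-degree r on the new vertices. This needs a + r = e g, and then every
-- new edge lies in exactly one new star. The new vertices get a colour ζ avoided by at least g old
-- vertices (one of two colours is, when 2g ≤ a), and one such old vertex goes into each new star,
-- so a proper k-colouring extends; the old system is a subsystem, so no (k−1)-colouring exists.
-- With Z = 2e, adding one vertex (g = 2q) takes the order qZ to qZ + 1, and adding the circulant
-- tournament on 2e − 1 vertices (g = 2q + 1) takes qZ + 1 to (q + 1)Z; alternating the two
-- reaches every admissible order above n₀.

module Submission where

open import Defs
open import Data.Nat using (ℕ; zero; suc; _*_; _+_; _∸_; _⊓_; _≤_; _<_; z≤n; s≤s; _≤?_)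
open import Data.Nat.Properties
  using ( ≤-trans; ≤-refl; ≤-reflexive; ≤-pred; ≤-<-trans; <⇒≤; <⇒≢; <⇒≱; <-irrefl; <-asym
        ; <-cmp; ≰⇒>; m≤m+n; m≤n+m; m≤n⇒m≤1+n; n≤1+n; m+n∸m≡n; m≤n⇒m⊓n≡m; m+[n∸m]≡n
        ; m∸n+n≡m; m∸n≤m; m≤n+o⇒m∸n≤o; m≤o∸n⇒m+n≤o; m+n≤o⇒m≤o∸n; [m+n]∸[m+o]≡n∸o
        ; +-monoʳ-<; +-monoˡ-≤; +-cancelˡ-<; +-cancelˡ-≡; +-cancelʳ-≡; +-cancelˡ-≤; +-comm
        ; +-suc; +-identityʳ; *-comm; *-cancelʳ-≤; *-cancelʳ-<; m+n≡0⇒m≡0; module ≤-Reasoning)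
open import Data.Nat.Divisibility using (_∣_; divides)
open import Data.Nat.Tactic.RingSolver using (solve-∀)
open import Data.Fin using (Fin; zero; suc; toℕ; fromℕ<; _↑ˡ_; _↑ʳ_; splitAt; _≟_)
open import Data.Fin.Properties
  using ( 0≢1+n; suc-injective; toℕ-fromℕ<; toℕ-injective; toℕ<n; ↑ˡ-injective; ↑ʳ-injective
        ; splitAt-↑ˡ; splitAt-↑ʳ; splitAt⁻¹-↑ˡ; splitAt⁻¹-↑ʳ)
open import Data.List
  using (List; []; _∷_; length; lookup; _++_; map; take; drop; concat; applyUpTo; filter; allFin)
open import Data.List.Properties
  using ( take++drop≡id; length-take; length-drop; length-applyUpTo; length-++; length-map
        ; length-tabulate; filter-++; ++-assoc)
open import Data.List.Relation.Unary.All as All using (All; []; _∷_)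
import Data.List.Relation.Unary.All.Properties as AllP
open import Data.List.Relation.Unary.Any as Any using (Any; here; there)
open import Data.List.Relation.Unary.Any.Properties using (lookup-index)
open import Data.List.Relation.Unary.AllPairs using (AllPairs; []; _∷_)
open import Data.List.Relation.Unary.Unique.Propositional using (Unique)
import Data.List.Relation.Unary.Unique.Propositional.Properties as Unique
open import Data.List.Membership.Propositional using (_∈_; _∉_)
open import Data.List.Membership.Propositional.Properties
  using ( ∈-lookup; ∈-++⁺ˡ; ∈-++⁺ʳ; ∈-++⁻; ∈-concat⁺′; ∈-applyUpTo⁺; ∈-applyUpTo⁻; ∈-map⁺; ∈-map⁻
        ; ∈-allFin)
open import Data.List.Relation.Binary.Permutation.Propositional
  using (_↭_; prep; ↭-sym; ↭-trans; ↭-refl; ↭⇒↭ₛ)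
open import Data.List.Relation.Binary.Permutation.Propositional.Properties
  using (++⁺ˡ; shifts; shift; ↭-length; All-resp-↭; ∈-resp-↭)
import Data.List.Relation.Binary.Permutation.Setoid.Properties as ↭ₛ
open import Data.Vec as Vec using (Vec; []; _∷_)
import Data.Vec.Relation.Unary.All as VecAll
import Data.Vec.Relation.Unary.All.Properties as VecAllP
import Data.Vec.Relation.Unary.Any as VecAny
import Data.Vec.Relation.Unary.AllPairs as VecAllPairs
import Data.Vec.Relation.Unary.AllPairs.Properties as VecAllPairsP
open import Data.Vec.Membership.Propositional using () renaming (_∈_ to _∈ᵥ_)
import Data.Vec.Membership.Propositional.Properties as VecMemP
open import Data.Product using (Σ; _,_; _×_; proj₁; proj₂)
open import Data.Sum as Sum using (_⊎_; inj₁; inj₂; [_,_]′)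
open import Data.Empty using (⊥-elim)
open import Data.Unit using (⊤)
open import Function using (_∘_)
open import Relation.Binary.Definitions using (tri<; tri≈; tri>)
open import Relation.Binary.PropositionalEquality
open import Relation.Binary.PropositionalEquality.Properties using (setoid)
open import Relation.Nullary using (¬_; yes; no; ¬?)
open import Relation.Unary using (Decidable)

data ExactlyOne {A : Set} (P : A → Set) : List A → Set where
  here  : ∀ {x xs} → P x → All (¬_ ∘ P) xs → ExactlyOne P (x ∷ xs)
  there : ∀ {x xs} → ¬ P x → ExactlyOne P xs → ExactlyOne P (x ∷ xs)

module _ {A : Set} {P : A → Set} where

  -- The uniqueness clause of IsStarSystem.
  UniqueLookup : List A → Set
  UniqueLookup xs = Σ (Fin (length xs)) (P ∘ lookup xs) ×
                    (∀ i j → P (lookup xs i) → P (lookup xs j) → i ≡ j)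

  ExactlyOne⇒UniqueLookup : ∀ {xs} → ExactlyOne P xs → UniqueLookup xs
  ExactlyOne⇒UniqueLookup (here px ¬pxs) = (zero , px) , unique
    where
    unique : ∀ i j → _ → _ → i ≡ j
    unique zero    zero    _  _  = refl
    unique zero    (suc j) _  pj = ⊥-elim (All.lookup ¬pxs (∈-lookup j) pj)
    unique (suc i) _       pi _  = ⊥-elim (All.lookup ¬pxs (∈-lookup i) pi)
  ExactlyOne⇒UniqueLookup (there ¬px one) with ExactlyOne⇒UniqueLookup one
  ... | (i , pi) , unique = (suc i , pi) , unique′
    where
    unique′ : ∀ i j → _ → _ → i ≡ j
    unique′ zero    _       p0 _  = ⊥-elim (¬px p0)
    unique′ (suc i) zero    _  p0 = ⊥-elim (¬px p0)
    unique′ (suc i) (suc j) pi pj = cong suc (unique i j pi pj)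

  UniqueLookup⇒ExactlyOne : ∀ xs → UniqueLookup xs → ExactlyOne P xs
  UniqueLookup⇒ExactlyOne [] ((() , _) , _)
  UniqueLookup⇒ExactlyOne (x ∷ xs) ((zero , px) , unique) =
    here px (All.tabulate λ y∈xs py →
      0≢1+n (unique zero (suc (Any.index y∈xs)) px (subst P (lookup-index y∈xs) py)))
  UniqueLookup⇒ExactlyOne (x ∷ xs) ((suc i , pi) , unique) =
    there (λ px → 0≢1+n (unique zero (suc i) px pi))
          (UniqueLookup⇒ExactlyOne xs ((i , pi) , λ j j′ pj pj′ →
            suc-injective (unique (suc j) (suc j′) pj pj′)))

  ExactlyOne-++⁺ˡ : ∀ {xs ys} → ExactlyOne P xs → All (¬_ ∘ P) ys → ExactlyOne P (xs ++ ys)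
  ExactlyOne-++⁺ˡ (here px ¬pxs) ¬pys = here px (AllP.++⁺ ¬pxs ¬pys)
  ExactlyOne-++⁺ˡ (there ¬px one) ¬pys = there ¬px (ExactlyOne-++⁺ˡ one ¬pys)

  ExactlyOne-++⁺ʳ : ∀ {xs ys} → All (¬_ ∘ P) xs → ExactlyOne P ys → ExactlyOne P (xs ++ ys)
  ExactlyOne-++⁺ʳ []           one = one
  ExactlyOne-++⁺ʳ (¬px ∷ ¬pxs) one = there ¬px (ExactlyOne-++⁺ʳ ¬pxs one)

  ExactlyOne-concatMap : ∀ {B : Set} (F : B → List A) {w ws} → Unique ws → w ∈ ws →
    ExactlyOne P (F w) → (∀ v → v ≢ w → All (¬_ ∘ P) (F v)) →
    ExactlyOne P (concat (map F ws))
  ExactlyOne-concatMap F {ws = v ∷ ws} (v∉ws ∷ ws!) (here refl) one none =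
    ExactlyOne-++⁺ˡ one (AllP.concat⁺ (AllP.map⁺ (All.tabulate {xs = ws} λ {u} u∈ws →
      none u λ { refl → All.lookup v∉ws u∈ws refl })))
  ExactlyOne-concatMap F {ws = v ∷ ws} (v∉ws ∷ ws!) (there w∈ws) one none =
    ExactlyOne-++⁺ʳ (none v λ { refl → All.lookup v∉ws w∈ws refl })
                    (ExactlyOne-concatMap F ws! w∈ws one none)

ExactlyOne-resp : ∀ {A : Set} {P Q R : A → Set} {xs} → All R xs →
  (∀ {x} → R x → P x → Q x) → (∀ {x} → R x → Q x → P x) →
  ExactlyOne P xs → ExactlyOne Q xs
ExactlyOne-resp (r ∷ rs) P⇒Q Q⇒P (here px ¬pxs) =
  here (P⇒Q r px) (All.zipWith (λ (r , ¬p) q → ¬p (Q⇒P r q)) (rs , ¬pxs))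
ExactlyOne-resp (r ∷ rs) P⇒Q Q⇒P (there ¬px one) =
  there (¬px ∘ Q⇒P r) (ExactlyOne-resp rs P⇒Q Q⇒P one)

ExactlyOne-map⁺ : ∀ {A B : Set} {P : B → Set} {Q : A → Set} (f : A → B) {xs} →
  (∀ {x} → P (f x) → Q x) → (∀ {x} → Q x → P (f x)) →
  ExactlyOne Q xs → ExactlyOne P (map f xs)
ExactlyOne-map⁺ f P⇒Q Q⇒P (here qx ¬qxs) = here (Q⇒P qx) (AllP.map⁺ (All.map (_∘ P⇒Q) ¬qxs))
ExactlyOne-map⁺ f P⇒Q Q⇒P (there ¬qx one) = there (¬qx ∘ P⇒Q) (ExactlyOne-map⁺ f P⇒Q Q⇒P one)

module _ {X : Set} where

  Unique-resp-↭ : ∀ {xs ys : List X} → xs ↭ ys → Unique xs → Unique ys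
  Unique-resp-↭ p = ↭ₛ.Unique-resp-↭ (setoid X) (↭⇒↭ₛ p)

  Unique-++⁻ˡ : ∀ (xs : List X) {ys} → Unique (xs ++ ys) → Unique xs
  Unique-++⁻ˡ []       _          = []
  Unique-++⁻ˡ (x ∷ xs) (x∉ ∷ xs!) = AllP.++⁻ˡ xs x∉ ∷ Unique-++⁻ˡ xs xs!

  Unique-++⁻ʳ : ∀ (xs : List X) {ys} → Unique (xs ++ ys) → Unique ys
  Unique-++⁻ʳ []       ys!       = ys!
  Unique-++⁻ʳ (x ∷ xs) (_ ∷ xs!) = Unique-++⁻ʳ xs xs!

  Unique-++⇒disjoint : ∀ (xs : List X) {ys z} → Unique (xs ++ ys) → z ∈ xs → z ∉ ys
  Unique-++⇒disjoint (x ∷ xs) (x∉ ∷ _)  (here refl)  z∈ys = All.lookup (AllP.++⁻ʳ xs x∉) z∈ys refl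
  Unique-++⇒disjoint (x ∷ xs) (_ ∷ xs!) (there z∈xs) = Unique-++⇒disjoint xs xs! z∈xs

  ExactlyOne-∈-concat : ∀ (xss : List (List X)) {z} → Unique (concat xss) → z ∈ concat xss →
    ExactlyOne (z ∈_) xss
  ExactlyOne-∈-concat (xs ∷ xss) u z∈ with ∈-++⁻ xs z∈
  ... | inj₁ z∈xs = here z∈xs (All.tabulate λ ys∈xss z∈ys →
                      Unique-++⇒disjoint xs u z∈xs (∈-concat⁺′ z∈ys ys∈xss))
  ... | inj₂ z∈rest = there (λ z∈xs → Unique-++⇒disjoint xs u z∈xs z∈rest)
                            (ExactlyOne-∈-concat xss (Unique-++⁻ʳ xs u) z∈rest)

  Unique-concat⁻ : ∀ (xss : List (List X)) → Unique (concat xss) → All Unique xss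
  Unique-concat⁻ []         _ = []
  Unique-concat⁻ (xs ∷ xss) u = Unique-++⁻ˡ xs u ∷ Unique-concat⁻ xss (Unique-++⁻ʳ xs u)

  vecOf : ∀ {l} (xs : List X) → length xs ≡ l → Vec X l
  vecOf []       refl = []
  vecOf (x ∷ xs) refl = x ∷ vecOf xs refl

  Any-vecOf⁺ : ∀ {l} {P : X → Set} {xs : List X} (p : length xs ≡ l) →
    Any P xs → VecAny.Any P (vecOf xs p)
  Any-vecOf⁺ refl (here px)   = VecAny.here px
  Any-vecOf⁺ refl (there pxs) = VecAny.there (Any-vecOf⁺ refl pxs)

  Any-vecOf⁻ : ∀ {l} {P : X → Set} {xs : List X} (p : length xs ≡ l) →
    VecAny.Any P (vecOf xs p) → Any P xs
  Any-vecOf⁻ {xs = _ ∷ _} refl (VecAny.here px)   = here px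
  Any-vecOf⁻ {xs = _ ∷ _} refl (VecAny.there pxs) = there (Any-vecOf⁻ refl pxs)

  All-vecOf : ∀ {l} {P : X → Set} {xs : List X} (p : length xs ≡ l) →
    All P xs → VecAll.All P (vecOf xs p)
  All-vecOf refl []         = VecAll.[]
  All-vecOf refl (px ∷ pxs) = px VecAll.∷ All-vecOf refl pxs

  AllPairs-vecOf : ∀ {l} {R : X → X → Set} {xs : List X} (p : length xs ≡ l) →
    AllPairs R xs → VecAllPairs.AllPairs R (vecOf xs p)
  AllPairs-vecOf refl []         = VecAllPairs.[]
  AllPairs-vecOf refl (rx ∷ rxs) = All-vecOf refl rx VecAllPairs.∷ AllPairs-vecOf refl rxs

module _ {A : Set} {P : A → Set} where

  All⇒∀lookup : ∀ {xs} → All P xs → ∀ i → P (lookup xs i)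
  All⇒∀lookup pxs i = All.lookup pxs (∈-lookup i)

  ∀lookup⇒All : ∀ xs → (∀ i → P (lookup xs i)) → All P xs
  ∀lookup⇒All xs p = All.tabulate λ x∈ → subst P (sym (lookup-index x∈)) (p (Any.index x∈))

Vec-∈-map⁻ : ∀ {A B : Set} (f : A → B) {l} {xs : Vec A l} {y} → y ∈ᵥ Vec.map f xs →
  Σ A λ x → x ∈ᵥ xs × y ≡ f x
Vec-∈-map⁻ f {xs = x ∷ _} (VecAny.here y≡fx) = x , VecAny.here refl , y≡fx
Vec-∈-map⁻ f {xs = _ ∷ _} (VecAny.there y∈) with x , x∈ , y≡fx ← Vec-∈-map⁻ f y∈ =
  x , VecAny.there x∈ , y≡fx

↭-filter-complement : ∀ {A : Set} {P : A → Set} (P? : Decidable P) xs →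
  xs ↭ filter P? xs ++ filter (¬? ∘ P?) xs
↭-filter-complement P? []       = ↭-refl
↭-filter-complement P? (x ∷ xs) with P? x
... | yes _ = prep x (↭-filter-complement P? xs)
... | no  _ = ↭-trans (prep x (↭-filter-complement P? xs)) (↭-sym (shift x (filter P? xs) _))

-- Fans: stars with a common centre

module _ {n e : ℕ} {s : Star n e} where

  EdgeIn-sym : ∀ {u v} → EdgeIn u v s → EdgeIn v u s
  EdgeIn-sym = Sum.swap

  EdgeIn-centre⁺ : ∀ {w v} → centre s ≡ w → v ∈ᵥ leaves s → EdgeIn w v s
  EdgeIn-centre⁺ s≡w v∈ = inj₁ (s≡w , v∈)

  EdgeIn-centre⁻ : ∀ {w v} → centre s ≡ w → v ≢ w → EdgeIn w v s → v ∈ᵥ leaves s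
  EdgeIn-centre⁻ _   _   (inj₁ (_ , v∈))  = v∈
  EdgeIn-centre⁻ s≡w v≢w (inj₂ (s≡v , _)) = ⊥-elim (v≢w (trans (sym s≡v) s≡w))

  ¬EdgeIn-off-centre : ∀ {w u v} → centre s ≡ w → w ≢ u → w ≢ v → ¬ EdgeIn u v s
  ¬EdgeIn-off-centre s≡w w≢u _   (inj₁ (s≡u , _)) = w≢u (trans (sym s≡w) s≡u)
  ¬EdgeIn-off-centre s≡w _   w≢v (inj₂ (s≡v , _)) = w≢v (trans (sym s≡w) s≡v)

ExactlyOne-EdgeIn-sym : ∀ {n e} {ss : List (Star n e)} {u v} →
  ExactlyOne (EdgeIn u v) ss → ExactlyOne (EdgeIn v u) ss
ExactlyOne-EdgeIn-sym = ExactlyOne-resp (All.universal {P = λ _ → ⊤} _ _)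
  (λ {s} _ → EdgeIn-sym {s = s}) (λ {s} _ → EdgeIn-sym {s = s})

module _ {X : Set} (e′ : ℕ) where

  blocks : List X → List X → List (List X)
  blocks []      _ = []
  blocks (h ∷ H) R = (h ∷ take e′ R) ∷ blocks H (drop e′ R)

  private
    length-drop-block : ∀ g (R : List X) → length R ≡ suc g * e′ → length (drop e′ R) ≡ g * e′
    length-drop-block g R eq =
      trans (length-drop e′ R) (trans (cong (_∸ e′) eq) (m+n∸m≡n e′ (g * e′)))

  blocks-length : ∀ H (R : List X) → length R ≡ length H * e′ →
    All (λ b → length b ≡ suc e′) (blocks H R)
  blocks-length []      R eq = []
  blocks-length (h ∷ H) R eq =
    cong suc (trans (length-take e′ R) (trans (cong (e′ ⊓_) eq) (m≤n⇒m⊓n≡m (m≤m+n e′ _))))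
    ∷ blocks-length H (drop e′ R) (length-drop-block (length H) R eq)

  concat-blocks-↭ : ∀ H (R : List X) → length R ≡ length H * e′ → concat (blocks H R) ↭ H ++ R
  concat-blocks-↭ []      [] _  = ↭-refl
  concat-blocks-↭ (h ∷ H) R  eq = prep h (↭-trans
    (++⁺ˡ (take e′ R) (concat-blocks-↭ H (drop e′ R) (length-drop-block (length H) R eq)))
    (subst (λ R′ → take e′ R ++ H ++ drop e′ R ↭ H ++ R′) (take++drop≡id e′ R)
           (shifts (take e′ R) H)))

  blocks-head : ∀ {P : X → Set} {H} R → All P H → All (Any P) (blocks H R)
  blocks-head R []        = []
  blocks-head R (ph ∷ pH) = here ph ∷ blocks-head (drop e′ R) pH

module _ {n e : ℕ} (w : Fin n) where

  ProperBlock : List (Fin n) → Set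
  ProperBlock b = length b ≡ e × Unique b × All (_≢ w) b

  fan : (bs : List (List (Fin n))) → All ProperBlock bs → List (Star n e)
  fan []       []                  = []
  fan (b ∷ bs) ((l , b! , b≢w) ∷ ps) =
    star w (vecOf b l) (AllPairs-vecOf l b!) (All-vecOf l b≢w) ∷ fan bs ps

  fan-centre : ∀ bs ps → All (λ s → centre s ≡ w) (fan bs ps)
  fan-centre []       []       = []
  fan-centre (b ∷ bs) (_ ∷ ps) = refl ∷ fan-centre bs ps

  fan-∉ : ∀ {z bs} ps → All (z ∉_) bs → All (¬_ ∘ (z ∈ᵥ_) ∘ leaves) (fan bs ps)
  fan-∉ []             []           = []
  fan-∉ ((l , _) ∷ ps) (z∉b ∷ z∉bs) = (z∉b ∘ Any-vecOf⁻ l) ∷ fan-∉ ps z∉bs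

  fan-∈ : ∀ {z bs} ps → ExactlyOne (z ∈_) bs → ExactlyOne ((z ∈ᵥ_) ∘ leaves) (fan bs ps)
  fan-∈ ((l , _) ∷ ps) (here z∈b z∉bs) = here (Any-vecOf⁺ l z∈b) (fan-∉ ps z∉bs)
  fan-∈ ((l , _) ∷ ps) (there z∉b one) = there (z∉b ∘ Any-vecOf⁻ l) (fan-∈ ps one)

  fan-Any : ∀ {P : Fin n → Set} {bs} ps → All (Any P) bs → All (VecAny.Any P ∘ leaves) (fan bs ps)
  fan-Any []             []         = []
  fan-Any ((l , _) ∷ ps) (pb ∷ pbs) = Any-vecOf⁺ l pb ∷ fan-Any ps pbs

-- Regular tournaments

record RegularTournament (m r : ℕ) : Set where
  field
    out             : Fin m → List (Fin m)
    out-unique      : ∀ v → Unique (out v)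
    out-irreflexive : ∀ v → v ∉ out v
    out-length      : ∀ v → length (out v) ≡ r
    orientation     : ∀ u v → u ≢ v → (v ∈ out u × u ∉ out v) ⊎ (u ∈ out v × v ∉ out u)

trivialTournament : RegularTournament 1 0
trivialTournament = record
  { out             = λ _ → []
  ; out-unique      = λ _ → []
  ; out-irreflexive = λ _ ()
  ; out-length      = λ _ → refl
  ; orientation     = λ { zero zero 0≢0 → ⊥-elim (0≢0 refl) }
  }

module _ {m : ℕ} where

  toFins : (xs : List ℕ) → All (_< m) xs → List (Fin m)
  toFins []       []         = []
  toFins (x ∷ xs) (x<m ∷ ps) = fromℕ< x<m ∷ toFins xs ps

  map-toℕ-toFins : ∀ xs ps → map toℕ (toFins xs ps) ≡ xs
  map-toℕ-toFins []       []         = refl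
  map-toℕ-toFins (x ∷ xs) (x<m ∷ ps) = cong₂ _∷_ (toℕ-fromℕ< x<m) (map-toℕ-toFins xs ps)

range : ℕ → ℕ → List ℕ
range s = applyUpTo (s +_)

∈-range⁻ : ∀ {s l j} → j ∈ range s l → s ≤ j × j < s + l
∈-range⁻ {s} j∈ with i , i<l , refl ← ∈-applyUpTo⁻ (s +_) j∈ = m≤m+n s i , +-monoʳ-< s i<l

∈-range⁺ : ∀ {s l j} → s ≤ j → j < s + l → j ∈ range s l
∈-range⁺ {s} {l} s≤j j<s+l rewrite sym (m+[n∸m]≡n s≤j) =
  ∈-applyUpTo⁺ (s +_) (+-cancelˡ-< s _ _ j<s+l)

range-unique : ∀ s l → Unique (range s l)
range-unique s l = Unique.applyUpTo⁺₁ (s +_) l λ i<j _ eq → <⇒≢ i<j (+-cancelˡ-≡ s _ _ eq)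

module Circulant (r : ℕ) where

  Beats : ℕ → ℕ → Set
  Beats i j = (i < j × j ≤ i + r) ⊎ (j + r < i)

  beats-irreflexive : ∀ {i} → ¬ Beats i i
  beats-irreflexive (inj₁ (i<i , _)) = <-irrefl refl i<i
  beats-irreflexive (inj₂ i+r<i)     = <⇒≱ i+r<i (m≤m+n _ r)

  beats-asym : ∀ {i j} → Beats i j → ¬ Beats j i
  beats-asym (inj₁ (i<j , _))   (inj₁ (j<i , _))   = <-asym i<j j<i
  beats-asym (inj₁ (_ , j≤i+r)) (inj₂ i+r<j)       = <⇒≱ i+r<j j≤i+r
  beats-asym (inj₂ j+r<i)       (inj₁ (_ , i≤j+r)) = <⇒≱ j+r<i i≤j+r
  beats-asym (inj₂ j+r<i)       (inj₂ i+r<j)       =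
    <-asym (≤-<-trans (m≤m+n _ r) j+r<i) (≤-<-trans (m≤m+n _ r) i+r<j)

  beats-or-beaten : ∀ {i j} → i < j → Beats i j ⊎ Beats j i
  beats-or-beaten {i} {j} i<j with j ≤? i + r
  ... | yes j≤i+r = inj₁ (inj₁ (i<j , j≤i+r))
  ... | no  j≰i+r = inj₂ (inj₂ (≰⇒> j≰i+r))

  beats-total : ∀ {i j} → i ≢ j → Beats i j ⊎ Beats j i
  beats-total {i} {j} i≢j with <-cmp i j
  ... | tri< i<j _ _ = beats-or-beaten i<j
  ... | tri≈ _ i≡j _ = ⊥-elim (i≢j i≡j)
  ... | tri> _ _ j<i = Sum.swap (beats-or-beaten j<i)

  -- i beats i+1, …, i+r modulo 2r+1
  outℕ : ℕ → List ℕ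
  outℕ i with i ≤? r
  ... | yes _ = range (suc i) r
  ... | no  _ = range (suc i) (r + r ∸ i) ++ range 0 (i ∸ r)

  ∈-outℕ⁻ : ∀ {i j} → i ≤ r + r → j ∈ outℕ i → Beats i j × j ≤ r + r
  ∈-outℕ⁻ {i} {j} i≤2r j∈ with i ≤? r
  ... | yes i≤r = let i<j , j<1+i+r = ∈-range⁻ j∈ in
                  inj₁ (i<j , ≤-pred j<1+i+r) , ≤-trans (≤-pred j<1+i+r) (+-monoˡ-≤ r i≤r)
  ... | no  i≰r with ∈-++⁻ (range (suc i) (r + r ∸ i)) j∈
  ...   | inj₁ j∈₁ = let i<j , j<1+2r = ∈-range⁻ j∈₁
                         j≤2r = ≤-pred (subst (j <_) (cong suc (m+[n∸m]≡n i≤2r)) j<1+2r) in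
                     inj₁ (i<j , ≤-trans j≤2r (+-monoˡ-≤ r (<⇒≤ (≰⇒> i≰r)))) , j≤2r
  ...   | inj₂ j∈₂ = let _ , j<i∸r = ∈-range⁻ j∈₂ in
                     inj₂ (m≤o∸n⇒m+n≤o (suc j) (<⇒≤ (≰⇒> i≰r)) j<i∸r) ,
                     ≤-trans (<⇒≤ j<i∸r) (≤-trans (m∸n≤m i r) i≤2r)

  ∈-outℕ⁺ : ∀ {i j} → i ≤ r + r → j ≤ r + r → Beats i j → j ∈ outℕ i
  ∈-outℕ⁺ {i} {j} i≤2r j≤2r i→j with i ≤? r | i→j
  ... | yes i≤r | inj₁ (i<j , j≤i+r) = ∈-range⁺ i<j (s≤s j≤i+r)
  ... | yes i≤r | inj₂ j+r<i         = ⊥-elim (<⇒≱ j+r<i (≤-trans i≤r (m≤n+m r j)))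
  ... | no  i≰r | inj₁ (i<j , _)     =
    ∈-++⁺ˡ (∈-range⁺ i<j (subst (j <_) (sym (cong suc (m+[n∸m]≡n i≤2r))) (s≤s j≤2r)))
  ... | no  i≰r | inj₂ j+r<i         =
    ∈-++⁺ʳ (range (suc i) (r + r ∸ i)) (∈-range⁺ z≤n (m+n≤o⇒m≤o∸n (suc j) j+r<i))

  outℕ-length : ∀ {i} → i ≤ r + r → length (outℕ i) ≡ r
  outℕ-length {i} i≤2r with i ≤? r
  ... | yes _   = length-applyUpTo (suc i +_) r
  ... | no  i≰r = begin
      length (range (suc i) (r + r ∸ i) ++ range 0 (i ∸ r))
        ≡⟨ length-++ (range (suc i) (r + r ∸ i)) ⟩
      length (range (suc i) (r + r ∸ i)) + length (range 0 (i ∸ r))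
        ≡⟨ cong₂ _+_ (length-applyUpTo (suc i +_) (r + r ∸ i))
                     (length-applyUpTo (0 +_) (i ∸ r)) ⟩
      (r + r ∸ i) + (i ∸ r)
        ≡⟨ cong (λ i′ → (r + r ∸ i′) + (i ∸ r)) (sym (m+[n∸m]≡n r≤i)) ⟩
      (r + r ∸ (r + (i ∸ r))) + (i ∸ r)
        ≡⟨ cong (_+ (i ∸ r)) ([m+n]∸[m+o]≡n∸o r r (i ∸ r)) ⟩
      (r ∸ (i ∸ r)) + (i ∸ r)
        ≡⟨ m∸n+n≡m (m≤n+o⇒m∸n≤o i r i≤2r) ⟩
      r ∎
    where
    open ≡-Reasoning
    r≤i = <⇒≤ (≰⇒> i≰r)

  outℕ-unique : ∀ i → Unique (outℕ i)
  outℕ-unique i with i ≤? r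
  ... | yes _   = range-unique (suc i) r
  ... | no  i≰r = Unique.++⁺ (range-unique (suc i) (r + r ∸ i)) (range-unique 0 (i ∸ r))
      λ (j∈₁ , j∈₂) → <⇒≱ (proj₂ (∈-range⁻ j∈₂))
                        (≤-trans (m∸n≤m i r) (<⇒≤ (proj₁ (∈-range⁻ j∈₁))))

  circulantTournament : RegularTournament (suc (r + r)) r
  circulantTournament = record
    { out             = out
    ; out-unique      = λ v → Unique.map⁻ (subst Unique (sym (out-toℕ v)) (outℕ-unique (toℕ v)))
    ; out-irreflexive = λ v v∈ → beats-irreflexive (proj₁ (∈-outℕ⁻ (bound v) (∈-out⁻ v v∈)))
    ; out-length      = λ v → trans (sym (length-map toℕ (out v)))
                                (trans (cong length (out-toℕ v)) (outℕ-length (bound v)))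
    ; orientation     = λ u v u≢v → Sum.map oriented oriented (beats-total (u≢v ∘ toℕ-injective))
    }
    where
    bound : (v : Fin (suc (r + r))) → toℕ v ≤ r + r
    bound v = ≤-pred (toℕ<n v)

    out : Fin (suc (r + r)) → List (Fin (suc (r + r)))
    out v = toFins (outℕ (toℕ v)) (All.tabulate (s≤s ∘ proj₂ ∘ ∈-outℕ⁻ (bound v)))

    out-toℕ : ∀ v → map toℕ (out v) ≡ outℕ (toℕ v)
    out-toℕ v = map-toℕ-toFins _ _

    ∈-out⁻ : ∀ {u} v → u ∈ out v → toℕ u ∈ outℕ (toℕ v)
    ∈-out⁻ v u∈ = subst (_ ∈_) (out-toℕ v) (∈-map⁺ toℕ u∈)

    ∈-out⁺ : ∀ {u} v → toℕ u ∈ outℕ (toℕ v) → u ∈ out v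
    ∈-out⁺ v u∈
      with u′ , u′∈ , eq ← ∈-map⁻ toℕ (subst (_ ∈_) (sym (out-toℕ v)) u∈) =
      subst (_∈ out v) (sym (toℕ-injective eq)) u′∈

    oriented : ∀ {u v} → Beats (toℕ u) (toℕ v) → v ∈ out u × u ∉ out v
    oriented {u} {v} u→v = ∈-out⁺ u (∈-outℕ⁺ (bound u) (bound v) u→v) ,
                           λ u∈ → beats-asym u→v (proj₁ (∈-outℕ⁻ (bound v) (∈-out⁻ v u∈)))

-- Adding a regular tournament to a chromatic star system

notColoured : ∀ {a k} → (Fin a → Fin k) → Fin k → List (Fin a) → List (Fin a)
notColoured c ζ = filter (λ u → ¬? (c u ≟ ζ))

length≤notColoured+notColoured : ∀ {a k} (c : Fin a → Fin k) {ζ₀ ζ₁} → ζ₀ ≢ ζ₁ → ∀ us →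
  length us ≤ length (notColoured c ζ₀ us) + length (notColoured c ζ₁ us)
length≤notColoured+notColoured c ζ₀≢ζ₁ [] = z≤n
length≤notColoured+notColoured c {ζ₀} {ζ₁} ζ₀≢ζ₁ (u ∷ us) with c u ≟ ζ₀ | c u ≟ ζ₁
... | yes u≡ζ₀ | yes u≡ζ₁ = ⊥-elim (ζ₀≢ζ₁ (trans (sym u≡ζ₀) u≡ζ₁))
... | yes _    | no  _    =
  ≤-trans (s≤s (length≤notColoured+notColoured c ζ₀≢ζ₁ us)) (≤-reflexive (sym (+-suc _ _)))
... | no  _    | yes _    = s≤s (length≤notColoured+notColoured c ζ₀≢ζ₁ us)
... | no  _    | no  _    =
  s≤s (≤-trans (m≤n⇒m≤1+n (length≤notColoured+notColoured c ζ₀≢ζ₁ us))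
               (≤-reflexive (sym (+-suc _ _))))

avoided-colour : ∀ {a k g} (c : Fin a → Fin (suc (suc k))) → 2 * g ≤ a →
  Σ (Fin (suc (suc k))) λ ζ → g ≤ length (notColoured c ζ (allFin a))
avoided-colour {a} {g = g} c 2g≤a with g ≤? length (notColoured c zero (allFin a))
... | yes g≤c₀ = zero , g≤c₀
... | no  g≰c₀ = suc zero , +-cancelˡ-≤ g g _ (begin
    g + g                  ≡⟨ cong (g +_) (sym (+-identityʳ g)) ⟩
    2 * g                  ≤⟨ 2g≤a ⟩
    a                      ≡⟨ sym (length-tabulate (λ u → u)) ⟩
    length (allFin a)      ≤⟨ length≤notColoured+notColoured c (λ ()) (allFin a) ⟩
    c₀ + c₁                ≤⟨ +-monoˡ-≤ c₁ (<⇒≤ (≰⇒> g≰c₀)) ⟩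
    g + c₁                 ∎)
  where
  open ≤-Reasoning
  c₀ = length (notColoured c zero (allFin a))
  c₁ = length (notColoured c (suc zero) (allFin a))

module Extension
  {k e′ a m r g : ℕ} (T : RegularTournament m r)
  (B : List (Star a (suc e′))) (B-system : IsStarSystem B)
  (c : Fin a → Fin k) (c-proper : ∀ i → ¬ Monochromatic c (lookup B i))
  (ζ : Fin k) (enough : g ≤ length (notColoured c ζ (allFin a)))
  (degree : a + r ≡ suc e′ * g)
  where

  open RegularTournament T

  old : Fin a → Fin (a + m)
  old u = u ↑ˡ m

  new : Fin m → Fin (a + m)
  new w = a ↑ʳ w

  old-injective : ∀ {u v} → old u ≡ old v → u ≡ v
  old-injective = ↑ˡ-injective m _ _

  new-injective : ∀ {w x} → new w ≡ new x → w ≡ x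
  new-injective = ↑ʳ-injective a _ _

  old≢new : ∀ {u w} → old u ≢ new w
  old≢new {u} {w} eq
    with () ← trans (sym (splitAt-↑ˡ a u m)) (trans (cong (splitAt a) eq) (splitAt-↑ʳ a m w))

  data OldOrNew : Fin (a + m) → Set where
    is-old : ∀ u → OldOrNew (old u)
    is-new : ∀ w → OldOrNew (new w)

  oldOrNew : ∀ x → OldOrNew x
  oldOrNew x with splitAt a {m} x in eq
  ... | inj₁ u = subst OldOrNew (splitAt⁻¹-↑ˡ eq) (is-old u)
  ... | inj₂ w = subst OldOrNew (splitAt⁻¹-↑ʳ eq) (is-new w)

  colour : Fin (a + m) → Fin k
  colour x = [ c , (λ _ → ζ) ]′ (splitAt a x)

  colour-old : ∀ u → colour (old u) ≡ c u
  colour-old u rewrite splitAt-↑ˡ a u m = refl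

  colour-new : ∀ w → colour (new w) ≡ ζ
  colour-new w rewrite splitAt-↑ʳ a m w = refl

  good? : Decidable (λ x → colour x ≢ ζ)
  good? x = ¬? (colour x ≟ ζ)

  notColoured≤good-old : ∀ us → length (notColoured c ζ us) ≤ length (filter good? (map old us))
  notColoured≤good-old []       = z≤n
  notColoured≤good-old (u ∷ us) with c u ≟ ζ | colour (old u) ≟ ζ
  ... | yes _   | yes _   = notColoured≤good-old us
  ... | yes _   | no  _   = m≤n⇒m≤1+n (notColoured≤good-old us)
  ... | no  u≢ζ | yes u≡ζ = ⊥-elim (u≢ζ (trans (sym (colour-old u)) u≡ζ))
  ... | no  _   | no  _   = s≤s (notColoured≤good-old us)

  neighbours : Fin m → List (Fin (a + m))
  neighbours w = map old (allFin a) ++ map new (out w)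

  neighbours-unique : ∀ w → Unique (neighbours w)
  neighbours-unique w =
    Unique.++⁺ (Unique.map⁺ old-injective (Unique.allFin⁺ a))
               (Unique.map⁺ new-injective (out-unique w))
      λ (x∈₁ , x∈₂) → old≢new (trans (sym (proj₂ (proj₂ (∈-map⁻ old x∈₁))))
                                     (proj₂ (proj₂ (∈-map⁻ new x∈₂))))

  new∉neighbours : ∀ w → All (_≢ new w) (neighbours w)
  new∉neighbours w = AllP.++⁺ (AllP.map⁺ (All.universal (λ _ → old≢new) (allFin a)))
    (AllP.map⁺ (All.tabulate λ v∈ v≡w →
      out-irreflexive w (subst (_∈ out w) (new-injective v≡w) v∈)))

  neighbours-length : ∀ w → length (neighbours w) ≡ a + r
  neighbours-length w = trans (length-++ (map old (allFin a)))
    (cong₂ _+_ (trans (length-map old (allFin a)) (length-tabulate (λ u → u)))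
               (trans (length-map new (out w)) (out-length w)))

  goodNeighbours badNeighbours : Fin m → List (Fin (a + m))
  goodNeighbours w = filter good? (neighbours w)
  badNeighbours  w = filter (¬? ∘ good?) (neighbours w)

  enough-good : ∀ w → g ≤ length (goodNeighbours w)
  enough-good w = begin
    g                                           ≤⟨ enough ⟩
    length (notColoured c ζ (allFin a))         ≤⟨ notColoured≤good-old (allFin a) ⟩
    length (filter good? (map old (allFin a)))  ≤⟨ m≤m+n _ _ ⟩
    length (filter good? (map old (allFin a))) + length (filter good? (map new (out w)))
      ≡⟨ sym (length-++ (filter good? (map old (allFin a)))) ⟩
    length (filter good? (map old (allFin a)) ++ filter good? (map new (out w)))
      ≡⟨ cong length (sym (filter-++ good? (map old (allFin a)) (map new (out w)))) ⟩
    length (goodNeighbours w) ∎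
    where open ≤-Reasoning

  heads rest : Fin m → List (Fin (a + m))
  heads w = take g (goodNeighbours w)
  rest  w = drop g (goodNeighbours w) ++ badNeighbours w

  neighbours-↭ : ∀ w → neighbours w ↭ heads w ++ rest w
  neighbours-↭ w = subst (neighbours w ↭_) heads++rest (↭-filter-complement good? (neighbours w))
    where
    heads++rest : goodNeighbours w ++ badNeighbours w ≡ heads w ++ rest w
    heads++rest = trans (cong (_++ badNeighbours w) (sym (take++drop≡id g (goodNeighbours w))))
                        (++-assoc (heads w) (drop g (goodNeighbours w)) (badNeighbours w))

  heads-length : ∀ w → length (heads w) ≡ g
  heads-length w = trans (length-take g (goodNeighbours w)) (m≤n⇒m⊓n≡m (enough-good w))

  rest-length : ∀ w → length (rest w) ≡ length (heads w) * e′
  rest-length w = +-cancelˡ-≡ g _ _ (begin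
    g + length (rest w)                  ≡⟨ cong (_+ length (rest w)) (sym (heads-length w)) ⟩
    length (heads w) + length (rest w)   ≡⟨ sym (length-++ (heads w)) ⟩
    length (heads w ++ rest w)           ≡⟨ sym (↭-length (neighbours-↭ w)) ⟩
    length (neighbours w)                ≡⟨ neighbours-length w ⟩
    a + r                                ≡⟨ degree ⟩
    g + e′ * g                           ≡⟨ cong (λ h → g + e′ * h) (sym (heads-length w)) ⟩
    g + e′ * length (heads w)            ≡⟨ cong (g +_) (*-comm e′ _) ⟩
    g + length (heads w) * e′            ∎)
    where open ≡-Reasoning

  leafBlocks : Fin m → List (List (Fin (a + m)))
  leafBlocks w = blocks e′ (heads w) (rest w)

  leafBlocks-↭ : ∀ w → concat (leafBlocks w) ↭ neighbours w
  leafBlocks-↭ w =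
    ↭-trans (concat-blocks-↭ e′ (heads w) (rest w) (rest-length w)) (↭-sym (neighbours-↭ w))

  leafBlocks-proper : ∀ w → All (ProperBlock (new w)) (leafBlocks w)
  leafBlocks-proper w = All.zip (blocks-length e′ (heads w) (rest w) (rest-length w) ,
    All.zip (Unique-concat⁻ _ (Unique-resp-↭ (↭-sym (leafBlocks-↭ w)) (neighbours-unique w)) ,
             AllP.concat⁻ (All-resp-↭ (↭-sym (leafBlocks-↭ w)) (new∉neighbours w))))

  newStars : Fin m → List (Star (a + m) (suc e′))
  newStars w = fan (new w) (leafBlocks w) (leafBlocks-proper w)

  lift : Star a (suc e′) → Star (a + m) (suc e′)
  lift s = star (old (centre s)) (Vec.map old (leaves s))
    (VecAllPairsP.map⁺ (VecAllPairs.map (_∘ old-injective) (leavesDistinct s)))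
    (VecAllP.map⁺ (VecAll.map (_∘ old-injective) (leavesNotCentre s)))

  system : List (Star (a + m) (suc e′))
  system = map lift B ++ concat (map newStars (allFin m))

  lift-EdgeIn⁺ : ∀ {u v} s → EdgeIn u v s → EdgeIn (old u) (old v) (lift s)
  lift-EdgeIn⁺ s = Sum.map (λ (s≡u , v∈) → cong old s≡u , VecMemP.∈-map⁺ old v∈)
                           (λ (s≡v , u∈) → cong old s≡v , VecMemP.∈-map⁺ old u∈)

  lift-EdgeIn⁻ : ∀ {u v} s → EdgeIn (old u) (old v) (lift s) → EdgeIn u v s
  lift-EdgeIn⁻ s = Sum.map (λ (s≡u , v∈) → old-injective s≡u , leaf v∈)
                           (λ (s≡v , u∈) → old-injective s≡v , leaf u∈)
    where
    leaf : ∀ {u} → old u ∈ᵥ Vec.map old (leaves s) → u ∈ᵥ leaves s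
    leaf u∈ with _ , x∈ , u≡x ← Vec-∈-map⁻ old u∈ =
      subst (_∈ᵥ leaves s) (sym (old-injective u≡x)) x∈

  ¬lift-EdgeIn-new : ∀ {x w} s → ¬ EdgeIn x (new w) (lift s)
  ¬lift-EdgeIn-new s (inj₁ (_ , w∈)) with _ , _ , w≡x ← Vec-∈-map⁻ old w∈ = old≢new (sym w≡x)
  ¬lift-EdgeIn-new s (inj₂ (s≡w , _)) = old≢new s≡w

  newStars-centre : ∀ w → All (λ s → centre s ≡ new w) (newStars w)
  newStars-centre w = fan-centre (new w) (leafBlocks w) (leafBlocks-proper w)

  newStars-∈ : ∀ {x} w → x ∈ neighbours w → ExactlyOne ((x ∈ᵥ_) ∘ leaves) (newStars w)
  newStars-∈ w x∈ = fan-∈ (new w) (leafBlocks-proper w)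
    (ExactlyOne-∈-concat (leafBlocks w)
      (Unique-resp-↭ (↭-sym (leafBlocks-↭ w)) (neighbours-unique w))
      (∈-resp-↭ (↭-sym (leafBlocks-↭ w)) x∈))

  newStars-∉ : ∀ {x} w → x ∉ neighbours w → All (¬_ ∘ (x ∈ᵥ_) ∘ leaves) (newStars w)
  newStars-∉ w x∉ = fan-∉ (new w) (leafBlocks-proper w)
    (All.tabulate λ b∈ x∈b → x∉ (∈-resp-↭ (leafBlocks-↭ w) (∈-concat⁺′ x∈b b∈)))

  ¬newStars-EdgeIn : ∀ {x y} w → new w ≢ x → new w ≢ y → All (¬_ ∘ EdgeIn x y) (newStars w)
  ¬newStars-EdgeIn w w≢x w≢y =
    All.map (λ {s} s≡w → ¬EdgeIn-off-centre {s = s} s≡w w≢x w≢y) (newStars-centre w)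

  ¬lifted-EdgeIn-new : ∀ {x w} → All (¬_ ∘ EdgeIn x (new w)) (map lift B)
  ¬lifted-EdgeIn-new = AllP.map⁺ (All.universal ¬lift-EdgeIn-new B)

  old-old-edge : ∀ {u v} → u ≢ v → ExactlyOne (EdgeIn (old u) (old v)) system
  old-old-edge {u} {v} u≢v = ExactlyOne-++⁺ˡ
    (ExactlyOne-map⁺ lift (λ {s} → lift-EdgeIn⁻ s) (λ {s} → lift-EdgeIn⁺ s)
      (UniqueLookup⇒ExactlyOne B (B-system u v u≢v)))
    (AllP.concat⁺ (AllP.map⁺ (All.universal
      (λ w → ¬newStars-EdgeIn w (old≢new ∘ sym) (old≢new ∘ sym)) (allFin m))))

  old-new-edge : ∀ u w → ExactlyOne (EdgeIn (old u) (new w)) system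
  old-new-edge u w = ExactlyOne-++⁺ʳ ¬lifted-EdgeIn-new
    (ExactlyOne-concatMap newStars (Unique.allFin⁺ m) (∈-allFin w)
      (ExactlyOne-resp (newStars-centre w)
        (λ {s} s≡w u∈ → EdgeIn-sym {s = s} (EdgeIn-centre⁺ {s = s} s≡w u∈))
        (λ {s} s≡w edge → EdgeIn-centre⁻ {s = s} s≡w old≢new (EdgeIn-sym {s = s} edge))
        (newStars-∈ w (∈-++⁺ˡ (∈-map⁺ old (∈-allFin u)))))
      λ v v≢w → ¬newStars-EdgeIn v (old≢new ∘ sym) (v≢w ∘ new-injective))

  new-new-edge : ∀ {w v} → v ∈ out w → w ∉ out v → ExactlyOne (EdgeIn (new w) (new v)) system
  new-new-edge {w} {v} v∈ w∉ = ExactlyOne-++⁺ʳ ¬lifted-EdgeIn-new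
    (ExactlyOne-concatMap newStars (Unique.allFin⁺ m) (∈-allFin w)
      (ExactlyOne-resp (newStars-centre w)
        (λ {s} → EdgeIn-centre⁺ {s = s})
        (λ {s} s≡w → EdgeIn-centre⁻ {s = s} s≡w (w≢v ∘ sym ∘ new-injective))
        (newStars-∈ w (∈-++⁺ʳ (map old (allFin a)) (∈-map⁺ new v∈))))
      others)
    where
    w≢v : w ≢ v
    w≢v refl = out-irreflexive w v∈

    new-w∉ : new w ∉ neighbours v
    new-w∉ w∈ with ∈-++⁻ (map old (allFin a)) w∈
    ... | inj₁ w∈old with _ , _ , w≡u ← ∈-map⁻ old w∈old = old≢new (sym w≡u)
    ... | inj₂ w∈new with _ , x∈ , w≡x ← ∈-map⁻ new w∈new =
      w∉ (subst (_∈ out v) (sym (new-injective w≡x)) x∈)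

    others : ∀ x → x ≢ w → All (¬_ ∘ EdgeIn (new w) (new v)) (newStars x)
    others x x≢w with x ≟ v
    ... | yes refl = All.zipWith
      (λ {s} (s≡v , w∉s) edge →
        w∉s (EdgeIn-centre⁻ {s = s} s≡v (w≢v ∘ new-injective) (EdgeIn-sym {s = s} edge)))
      (newStars-centre v , newStars-∉ v new-w∉)
    ... | no x≢v  = ¬newStars-EdgeIn x (x≢w ∘ new-injective) (x≢v ∘ new-injective)

  system-edge : ∀ x y → x ≢ y → ExactlyOne (EdgeIn x y) system
  system-edge x y x≢y with oldOrNew x | oldOrNew y
  ... | is-old u | is-old v = old-old-edge (x≢y ∘ cong old)
  ... | is-old u | is-new w = old-new-edge u w
  ... | is-new w | is-old u = ExactlyOne-EdgeIn-sym (old-new-edge u w)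
  ... | is-new w | is-new v with orientation w v (x≢y ∘ cong new)
  ...   | inj₁ (v∈ , w∉) = new-new-edge v∈ w∉
  ...   | inj₂ (w∈ , v∉) = ExactlyOne-EdgeIn-sym (new-new-edge w∈ v∉)

  system-isStarSystem : IsStarSystem system
  system-isStarSystem x y x≢y = ExactlyOne⇒UniqueLookup (system-edge x y x≢y)

  lift-proper : ∀ s → ¬ Monochromatic c s → ¬ Monochromatic colour (lift s)
  lift-proper s not-mono mono = not-mono
    (VecAll.map (λ {v} same → trans (sym (colour-old v)) (trans same (colour-old (centre s))))
                (VecAllP.map⁻ mono))

  newStars-proper : ∀ w → All (¬_ ∘ Monochromatic colour) (newStars w)
  newStars-proper w = All.zipWith
    (λ {s} (s≡w , good) mono → VecAll.lookupWith
      (λ same bad → bad (trans same (trans (cong colour s≡w) (colour-new w)))) mono good)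
    (newStars-centre w , fan-Any (new w) (leafBlocks-proper w)
      (blocks-head e′ (rest w) (AllP.take⁺ g (AllP.all-filter good? (neighbours w)))))

  system-colourable : Colourable k system
  system-colourable = colour , All⇒∀lookup (AllP.++⁺
    (AllP.map⁺ (∀lookup⇒All B (λ i → lift-proper (lookup B i) (c-proper i))))
    (AllP.concat⁺ (AllP.map⁺ (All.universal newStars-proper (allFin m)))))

  restrict : ∀ {j} → Colourable j system → Colourable j B
  restrict (d , d-proper) = d ∘ old , All⇒∀lookup (All.map (λ {s} → lifted {s})
    (AllP.map⁻ {f = lift} (AllP.++⁻ˡ (map lift B)
      (∀lookup⇒All {P = ¬_ ∘ Monochromatic d} system d-proper))))
    where
    lifted : ∀ {s} → ¬ Monochromatic d (lift s) → ¬ Monochromatic (d ∘ old) s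
    lifted not-mono = not-mono ∘ VecAllP.map⁺

extend : ∀ {k e′ a m r g} → RegularTournament m r → a + r ≡ suc e′ * g → 2 * g ≤ a → 2 ≤ k →
  ExistsChromaticStarSystem k (suc e′) a → ExistsChromaticStarSystem k (suc e′) (a + m)
extend T degree 2g≤a (s≤s (s≤s _)) (B , B-system , (c , c-proper) , not-colourable)
  with ζ , enough ← avoided-colour c 2g≤a =
  system , system-isStarSystem , system-colourable , not-colourable ∘ restrict
  where open Extension T B B-system c c-proper ζ enough degree

-- Admissible orders

star-order : ∀ {n e′} → Star n (suc e′) → 2 ≤ n
star-order {suc (suc _)} _                                         = s≤s (s≤s z≤n)
star-order {suc zero}    (star zero (zero ∷ _) _ (0≢0 VecAll.∷ _)) = ⊥-elim (0≢0 refl)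

chromatic⇒2≤order : ∀ {k e′ n} → 2 ≤ k → ExistsChromaticStarSystem k (suc e′) n → 2 ≤ n
chromatic⇒2≤order _             (s ∷ _ , _)                   = star-order s
chromatic⇒2≤order (s≤s (s≤s _)) ([] , _ , _ , not-colourable) =
  ⊥-elim (not-colourable ((λ _ → zero) , λ ()))

data Admissible (z : ℕ) : ℕ → Set where
  multiple  : ∀ q → Admissible z (q * z)
  successor : ∀ q → Admissible z (1 + q * z)

admissible : ∀ {z} n → suc z ∣ n ⊎ suc z ∣ n + z → Admissible (suc z) n
admissible n (inj₁ (divides q refl)) = multiple q
admissible n (inj₂ (divides zero n+z≡0)) =
  subst (Admissible _) (sym (m+n≡0⇒m≡0 n n+z≡0)) (multiple 0)
admissible {z} n (inj₂ (divides (suc q) n+z≡z+qz)) =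
  subst (Admissible _)
        (sym (+-cancelʳ-≡ z n (1 + q * suc z) (trans n+z≡z+qz (cong suc (+-comm z _)))))
        (successor q)

module AdmissibleOrders (k e″ : ℕ) (2≤k : 2 ≤ k) where

  e′ : ℕ
  e′ = suc (suc e″)

  Z : ℕ
  Z = 2 * suc e′

  Ex : ℕ → Set
  Ex = ExistsChromaticStarSystem k (suc e′)

  to-successor : ∀ q → Ex (q * Z) → Ex (1 + q * Z)
  to-successor q ex =
    subst Ex (+-comm (q * Z) 1) (extend {g = 2 * q} trivialTournament (degree q e′) 4q≤qZ 2≤k ex)
    where
    degree : ∀ q e′ → q * (2 * suc e′) + 0 ≡ suc e′ * (2 * q)
    degree = solve-∀

    excess : ∀ q e″ → q * (2 * suc (suc (suc e″))) ≡ 2 * (2 * q) + (2 * q + 2 * e″ * q)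
    excess = solve-∀

    4q≤qZ : 2 * (2 * q) ≤ q * Z
    4q≤qZ = subst (2 * (2 * q) ≤_) (sym (excess q e″)) (m≤m+n (2 * (2 * q)) (2 * q + 2 * e″ * q))

  -- 2g ≤ a needs q ≥ 1 here, and for q = 1 it is exactly where e ≥ 3 is used.
  to-multiple : ∀ q → 1 ≤ q → Ex (1 + q * Z) → Ex (suc q * Z)
  to-multiple (suc p) _ ex =
    subst Ex (order p e′)
      (extend {g = 1 + 2 * suc p} (Circulant.circulantTournament e′) (degree p e′) 2g≤a 2≤k ex)
    where
    degree : ∀ p e′ → (1 + suc p * (2 * suc e′)) + e′ ≡ suc e′ * (1 + 2 * suc p)
    degree = solve-∀

    order : ∀ p e′ → (1 + suc p * (2 * suc e′)) + suc (e′ + e′) ≡ suc (suc p) * (2 * suc e′)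
    order = solve-∀

    excess : ∀ p e″ →
      1 + suc p * (2 * suc (suc (suc e″))) ≡ 2 * (1 + 2 * suc p) + (1 + 2 * p + 2 * e″ * suc p)
    excess = solve-∀

    2g≤a : 2 * (1 + 2 * suc p) ≤ 1 + suc p * Z
    2g≤a = subst (2 * (1 + 2 * suc p) ≤_) (sym (excess p e″))
                 (m≤m+n (2 * (1 + 2 * suc p)) (1 + 2 * p + 2 * e″ * suc p))

  successors-from : ∀ {q₀} → 1 ≤ q₀ → Ex (1 + q₀ * Z) → ∀ q → q₀ ≤ q → Ex (1 + q * Z)
  successors-from {q₀} 1≤q₀ ex q q₀≤q =
    subst (λ q → Ex (1 + q * Z)) (m∸n+n≡m q₀≤q) (iterate (q ∸ q₀))
    where
    iterate : ∀ t → Ex (1 + (t + q₀) * Z)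
    iterate zero    = ex
    iterate (suc t) =
      to-successor (suc (t + q₀)) (to-multiple (t + q₀) (≤-trans 1≤q₀ (m≤n+m q₀ t)) (iterate t))

  chromatic-successor-below : ∀ {n₀} → Admissible Z n₀ → 2 ≤ n₀ → Ex n₀ →
    Σ ℕ λ q₀ → 1 ≤ q₀ × q₀ * Z ≤ n₀ × Ex (1 + q₀ * Z)
  chromatic-successor-below (multiple (suc q))  _ ex =
    suc q , s≤s z≤n , ≤-refl , to-successor (suc q) ex
  chromatic-successor-below (successor (suc q)) _ ex = suc q , s≤s z≤n , n≤1+n _ , ex
  chromatic-successor-below (successor zero) (s≤s ())

  chromatic-above : ∀ {q₀ n₀ n} → 1 ≤ q₀ → Ex (1 + q₀ * Z) → q₀ * Z ≤ n₀ → n₀ < n →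
    Admissible Z n → Ex n
  chromatic-above {q₀} 1≤q₀ ex q₀Z≤n₀ n₀<n (successor q) =
    successors-from 1≤q₀ ex q (*-cancelʳ-≤ q₀ q Z (≤-pred (≤-<-trans q₀Z≤n₀ n₀<n)))
  chromatic-above {q₀} 1≤q₀ ex q₀Z≤n₀ n₀<n (multiple q)
    with *-cancelʳ-< Z q₀ q (≤-<-trans q₀Z≤n₀ n₀<n)
  ... | s≤s {n = p} q₀≤p = to-multiple p (≤-trans 1≤q₀ q₀≤p) (successors-from 1≤q₀ ex p q₀≤p)

theorem3p2 : ∀ (k e n₀ : ℕ) → 2 ≤ k → 3 ≤ e →
    ((2 * e) ∣ n₀ ⊎ (2 * e) ∣ (n₀ + (2 * e ∸ 1))) →
    ExistsChromaticStarSystem k e n₀ →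
    ∀ (n : ℕ) → n₀ < n → ((2 * e) ∣ n ⊎ (2 * e) ∣ (n + (2 * e ∸ 1))) →
    ExistsChromaticStarSystem k e n
theorem3p2 k (suc (suc (suc e″))) n₀ 2≤k (s≤s (s≤s (s≤s z≤n)))
           n₀-admissible ex₀ n n₀<n n-admissible =
  let _ , 1≤q₀ , q₀Z≤n₀ , ex =
        chromatic-successor-below (admissible n₀ n₀-admissible) (chromatic⇒2≤order 2≤k ex₀) ex₀
  in chromatic-above 1≤q₀ ex q₀Z≤n₀ n₀<n (admissible n n-admissible)
  where open AdmissibleOrders k e″ 2≤k
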